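{- Let $\mathbf U=\langle\langle U,\approx\rangle,\preceq\rangle$ be a completely lattice $\mathbf L$-ordered set and $\sim$ a complete $\mathbf L$-tolerance on $\mathbf U$. Then the pair of maps $\langle{}_\sim,{}^\sim\rangle$, $u\mapsto u_\sim$ and $u\mapsto u^\sim$, is an extensive isotone $\mathbf L$-Galois connection on $\mathbf U$.
   Context: $\mathbf L=\langle L,\wedge,\vee,\otimes,\to,0,1\rangle$ is a complete residuated lattice ($\langle L,\wedge,\vee,0,1\rangle$ complete lattice, $\langle L,\otimes,1\rangle$ commutative monoid, $a\otimes b\le c$ iff $a\le b\to c$). An $\mathbf L$-set in $X$ is a map $X\to L$; $L^X$ the set of them; $S(A,B)=\bigwedge_x(A(x)\to B(x))$. An $\mathbf L$-equality is a binary $\mathbf L$-relation that is reflexive, symmetric, transitive ($R(x,y)\otimes R(y,z)\le R(x,z)$) and with $R(x,y)=1\Rightarrow x=y$. An $\mathbf L$-ordered set is $\langle\langle U,\approx\rangle,\preceq\rangle$, $\approx$ an $\mathbf L$-equality, $\preceq$ reflexive, transitive, compatible with $\approx$ ($(u\preceq v)\otimes(u\approx u')\otimes(v\approx v')\le(u'\preceq v')$), and $(u\preceq v)\wedge(v\preceq u)\le u\approx v$; $u\le v$ means $(u\preceq v)=1$. For $V\in L^U$: $\mathcal L V(v)=\bigwedge_u(V(u)\to(v\preceq u))$, $\mathcal U V(v)=\bigwedge_u(V(u)\to(u\preceq v))$; $\inf V$ is the unique $u$ with $\mathcal L V(u)=1=\mathcal U(\mathcal L V)(u)$, $\sup V$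 the unique $u$ with $\mathcal U V(u)=1=\mathcal L(\mathcal U V)(u)$; completely lattice means these exist for all $V$. Power relation: for $R$ on $X$, $A,B\in L^X$, $(R\circ B)(x)=\bigvee_y R(x,y)\otimes B(y)$, $(A\circ R)(y)=\bigvee_x A(x)\otimes R(x,y)$, $R^+(A,B)=S(A,R\circ B)\wedge S(B,A\circ R)$. A binary $\mathbf L$-relation $R$ on $\mathbf U$ is complete if it is compatible with $\approx$ ($R(u,v)\otimes(u\approx u')\otimes(v\approx v')\le R(u',v')$) and $R^+(V_1,V_2)\le R(\inf V_1,\inf V_2)$, $R^+(V_1,V_2)\le R(\sup V_1,\sup V_2)$ for all $V_1,V_2\in L^U$. An $\mathbf L$-tolerance is a reflexive symmetric binary $\mathbf L$-relation. For $u\in U$, $[u]_\sim(v)=u\sim v$, $u_\sim=\inf[u]_\sim$, $u^\sim=\sup[u]_\sim$. An isotone $\mathbf L$-Galois connection on $\mathbf U$ is a pair $\langle f,g\rangle$ of maps $U\to U$ with $(f(u)\preceq v)=(u\preceq g(v))$ for all $u,v$; it is extensive if $f(u)\le u$ and $g(u)\ge u$ for all $u$. -}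

module Defs where

open import Data.Bool using (Bool; true; false)
open import Data.Empty using (⊥)
open import Data.Product using (Σ; _×_; _,_; proj₁)
open import Relation.Binary.PropositionalEquality using (_≡_)

record CRL : Set₁ where
  infixr 6 _⇒_
  infixl 7 _⊗_
  infix 4 _≤_
  field
    L        : Set
    _≤_      : L → L → Set
    ≤-refl   : ∀ {a} → a ≤ a
    ≤-trans  : ∀ {a b c} → a ≤ b → b ≤ c → a ≤ c
    ≤-antisym : ∀ {a b} → a ≤ b → b ≤ a → a ≡ b
    ⋀        : {I : Set} → (I → L) → L
    ⋀-lb     : ∀ {I : Set} (f : I → L) (i : I) → ⋀ f ≤ f i
    ⋀-glb    : ∀ {I : Set} (f : I → L) (a : L) → (∀ i → a ≤ f i) → a ≤ ⋀ f
    ⋁        : {I : Set} → (I → L) → L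
    ⋁-ub     : ∀ {I : Set} (f : I → L) (i : I) → f i ≤ ⋁ f
    ⋁-lub    : ∀ {I : Set} (f : I → L) (a : L) → (∀ i → f i ≤ a) → ⋁ f ≤ a
    _⊗_      : L → L → L
    _⇒_      : L → L → L
  𝟏 : L
  𝟏 = ⋀ {⊥} (λ ())
  𝟎 : L
  𝟎 = ⋁ {⊥} (λ ())
  _∧_ : L → L → L
  a ∧ b = ⋀ {Bool} (λ { true → a ; false → b })
  _∨_ : L → L → L
  a ∨ b = ⋁ {Bool} (λ { true → a ; false → b })
  field
    ⊗-comm   : ∀ a b → a ⊗ b ≡ b ⊗ a
    ⊗-assoc  : ∀ a b c → (a ⊗ b) ⊗ c ≡ a ⊗ (b ⊗ c)
    ⊗-identityʳ : ∀ a → a ⊗ 𝟏 ≡ a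
    adj→     : ∀ {a b c} → a ⊗ b ≤ c → a ≤ b ⇒ c
    adj←     : ∀ {a b c} → a ≤ b ⇒ c → a ⊗ b ≤ c

module _ (𝐋 : CRL) where
  open CRL 𝐋

  S : {X : Set} → (X → L) → (X → L) → L
  S A B = ⋀ (λ x → A x ⇒ B x)

  _∘ʳ_ : {X : Set} → (X → X → L) → (X → L) → (X → L)
  (R ∘ʳ B) x = ⋁ (λ y → R x y ⊗ B y)

  _ˡ∘_ : {X : Set} → (X → L) → (X → X → L) → (X → L)
  (A ˡ∘ R) y = ⋁ (λ x → A x ⊗ R x y)

  _⁺ : {X : Set} → (X → X → L) → (X → L) → (X → L) → L
  (R ⁺) A B = S A (R ∘ʳ B) ∧ S B (A ˡ∘ R)

  record IsLEquality {X : Set} (_≈_ : X → X → L) : Set where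
    field
      refl  : ∀ x → (x ≈ x) ≡ 𝟏
      sym   : ∀ x y → (x ≈ y) ≡ (y ≈ x)
      trans : ∀ x y z → (x ≈ y) ⊗ (y ≈ z) ≤ (x ≈ z)
      sep   : ∀ x y → (x ≈ y) ≡ 𝟏 → x ≡ y

  record LOrderedSet : Set₁ where
    field
      U   : Set
      _≈_ : U → U → L
      _≼_ : U → U → L
      ≈-isLEquality : IsLEquality _≈_
      ≼-refl   : ∀ u → (u ≼ u) ≡ 𝟏
      ≼-trans  : ∀ u v w → (u ≼ v) ⊗ (v ≼ w) ≤ (u ≼ w)
      ≼-compat : ∀ u v u' v' → (u ≼ v) ⊗ (u ≈ u') ⊗ (v ≈ v') ≤ (u' ≼ v')
      ≼-antisym : ∀ u v → (u ≼ v) ∧ (v ≼ u) ≤ (u ≈ v)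

    _≤ᵤ_ : U → U → Set
    u ≤ᵤ v = (u ≼ v) ≡ 𝟏

    𝓛 : (U → L) → (U → L)
    𝓛 V v = ⋀ (λ u → V u ⇒ (v ≼ u))
    𝓤 : (U → L) → (U → L)
    𝓤 V v = ⋀ (λ u → V u ⇒ (u ≼ v))

    IsInf : (U → L) → U → Set
    IsInf V u = (𝓛 V u ≡ 𝟏) × (𝓤 (𝓛 V) u ≡ 𝟏)
    IsSup : (U → L) → U → Set
    IsSup V u = (𝓤 V u ≡ 𝟏) × (𝓛 (𝓤 V) u ≡ 𝟏)

  -- completely lattice: infima and suprema exist for all V
  -- (they are unique, so the witnesses below are THE inf / sup)
  record CompletelyLattice (𝐔 : LOrderedSet) : Set where
    open LOrderedSet 𝐔
    field
      inf   : (U → L) → U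
      inf-is : ∀ V → IsInf V (inf V)
      sup   : (U → L) → U
      sup-is : ∀ V → IsSup V (sup V)

  module _ {𝐔 : LOrderedSet} (cl : CompletelyLattice 𝐔) where
    open LOrderedSet 𝐔
    open CompletelyLattice cl

    IsTolerance : (U → U → L) → Set
    IsTolerance R = (∀ u → R u u ≡ 𝟏) × (∀ u v → R u v ≡ R v u)

    IsCompleteRel : (U → U → L) → Set
    IsCompleteRel R =
      (∀ u v u' v' → R u v ⊗ (u ≈ u') ⊗ (v ≈ v') ≤ R u' v')
      × (∀ V₁ V₂ → (R ⁺) V₁ V₂ ≤ R (inf V₁) (inf V₂))
      × (∀ V₁ V₂ → (R ⁺) V₁ V₂ ≤ R (sup V₁) (sup V₂))

    class : (U → U → L) → U → (U → L)
    class R u v = R u v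

    lowerᵗ : (U → U → L) → U → U
    lowerᵗ R u = inf (class R u)

    upperᵗ : (U → U → L) → U → U
    upperᵗ R u = sup (class R u)

    IsIsotoneGalois : (U → U) → (U → U) → Set
    IsIsotoneGalois f g = ∀ u v → (f u ≼ v) ≡ (u ≼ g v)

    IsExtensive : (U → U) → (U → U) → Set
    IsExtensive f g = (∀ u → f u ≤ᵤ u) × (∀ u → u ≤ᵤ g u)

-- Completeness of ∼, applied to [u]∼ and the singleton {u}, gives (u_∼ ∼ u) = 1; hence
-- u_∼ ≤ u and u ≤ (u_∼)^∼. Applied to the pairs {u, v} and {u, y} it shows that u ↦ u_∼ is
-- isotone to the degree u ≼ v, because inf {u, v} ≈ u holds to that degree. Reversing the
-- order swaps inf and sup and keeps ∼ complete, so the same holds dually for u ↦ u^∼; two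
-- isotone maps f, g with f ∘ g ≤ id ≤ g ∘ f form an isotone Galois connection.
module Submission where

open import Data.Bool using (true; false)
open import Data.Product using (_×_; _,_; proj₁; proj₂)
open import Relation.Binary.Bundles using (Poset)
open import Relation.Binary.PropositionalEquality as ≡ using (_≡_; cong)
import Relation.Binary.Reasoning.PartialOrder as PosetReasoning

open import Defs

module ResiduatedLatticeProperties (𝐋 : CRL) where
  open CRL 𝐋

  ≤-poset : Poset _ _ _
  ≤-poset = record
    { isPartialOrder = record
      { isPreorder = record
        { isEquivalence = ≡.isEquivalence
        ; reflexive = λ { ≡.refl → ≤-refl }
        ; trans = ≤-trans
        }
      ; antisym = ≤-antisym
      }
    }

  open PosetReasoning ≤-poset

  ≤-reflexive : ∀ {a b} → a ≡ b → a ≤ b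
  ≤-reflexive ≡.refl = ≤-refl

  x≤𝟏 : ∀ {a} → a ≤ 𝟏
  x≤𝟏 {a} = ⋀-glb (λ ()) a (λ ())

  𝟏≤⇒≡𝟏 : ∀ {a} → 𝟏 ≤ a → a ≡ 𝟏
  𝟏≤⇒≡𝟏 = ≤-antisym x≤𝟏

  ⊗-identityˡ : ∀ a → 𝟏 ⊗ a ≡ a
  ⊗-identityˡ a = ≡.trans (⊗-comm 𝟏 a) (⊗-identityʳ a)

  ⊗-monoʳ-≤ : ∀ a {b c} → b ≤ c → a ⊗ b ≤ a ⊗ c
  ⊗-monoʳ-≤ a {b} {c} b≤c = begin
    a ⊗ b  ≡⟨ ⊗-comm a b ⟩
    b ⊗ a  ≤⟨ adj← (≤-trans b≤c (adj→ (≤-reflexive (⊗-comm c a)))) ⟩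
    a ⊗ c  ∎

  ⊗-monoˡ-≤ : ∀ a {b c} → b ≤ c → b ⊗ a ≤ c ⊗ a
  ⊗-monoˡ-≤ a {b} {c} b≤c = begin
    b ⊗ a  ≡⟨ ⊗-comm b a ⟩
    a ⊗ b  ≤⟨ ⊗-monoʳ-≤ a b≤c ⟩
    a ⊗ c  ≡⟨ ⊗-comm a c ⟩
    c ⊗ a  ∎

  ⊗-mono-≤ : ∀ {a b c d} → a ≤ b → c ≤ d → a ⊗ c ≤ b ⊗ d
  ⊗-mono-≤ {b = b} {c = c} a≤b c≤d = ≤-trans (⊗-monoˡ-≤ c a≤b) (⊗-monoʳ-≤ b c≤d)

  x⊗y≤y : ∀ {a b} → a ⊗ b ≤ b
  x⊗y≤y {a} {b} = ≤-trans (⊗-monoˡ-≤ b x≤𝟏) (≤-reflexive (⊗-identityˡ b))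

  x≤x⊗y : ∀ {a b} → b ≡ 𝟏 → a ≤ a ⊗ b
  x≤x⊗y {a} ≡.refl = ≤-reflexive (≡.sym (⊗-identityʳ a))

  x≤y⊗x : ∀ {a b} → b ≡ 𝟏 → a ≤ b ⊗ a
  x≤y⊗x {a} ≡.refl = ≤-reflexive (≡.sym (⊗-identityˡ a))

  ⊗-swapʳ : ∀ a b c → (a ⊗ b) ⊗ c ≡ (a ⊗ c) ⊗ b
  ⊗-swapʳ a b c = begin-equality
    (a ⊗ b) ⊗ c  ≡⟨ ⊗-assoc a b c ⟩
    a ⊗ (b ⊗ c)  ≡⟨ cong (a ⊗_) (⊗-comm b c) ⟩
    a ⊗ (c ⊗ b)  ≡⟨ ⊗-assoc a c b ⟨
    (a ⊗ c) ⊗ b  ∎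

  ∧-greatest : ∀ {a b c} → a ≤ b → a ≤ c → a ≤ b ∧ c
  ∧-greatest {a} a≤b a≤c = ⋀-glb _ a (λ { true → a≤b ; false → a≤c })

  ∨-≡𝟏ˡ : ∀ {a b} → a ≡ 𝟏 → a ∨ b ≡ 𝟏
  ∨-≡𝟏ˡ ≡.refl = 𝟏≤⇒≡𝟏 (⋁-ub _ true)

  ∨-≡𝟏ʳ : ∀ {a b} → b ≡ 𝟏 → a ∨ b ≡ 𝟏
  ∨-≡𝟏ʳ ≡.refl = 𝟏≤⇒≡𝟏 (⋁-ub _ false)

  ⊗-∨-least : ∀ {a b c d} → a ⊗ b ≤ d → a ⊗ c ≤ d → a ⊗ (b ∨ c) ≤ d
  ⊗-∨-least {a} {b} {c} {d} ab≤d ac≤d = begin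
    a ⊗ (b ∨ c)  ≡⟨ ⊗-comm a (b ∨ c) ⟩
    (b ∨ c) ⊗ a  ≤⟨ adj← (⋁-lub _ (a ⇒ d) λ
                      { true  → adj→ (≤-trans (≤-reflexive (⊗-comm b a)) ab≤d)
                      ; false → adj→ (≤-trans (≤-reflexive (⊗-comm c a)) ac≤d) }) ⟩
    d            ∎

  ≤-⋁ : ∀ {I : Set} {a} (f : I → L) (i : I) → a ≤ f i → a ≤ ⋁ f
  ≤-⋁ f i a≤fi = ≤-trans a≤fi (⋁-ub f i)

  ⋀-≡𝟏 : ∀ {I : Set} (f : I → L) → ⋀ f ≡ 𝟏 → ∀ i → f i ≡ 𝟏
  ⋀-≡𝟏 f ⋀f≡𝟏 i = 𝟏≤⇒≡𝟏 (≤-trans (≤-reflexive (≡.sym ⋀f≡𝟏)) (⋀-lb f i))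

  ⇒-≡𝟏 : ∀ {a b} → a ⇒ b ≡ 𝟏 → a ≤ b
  ⇒-≡𝟏 {a} {b} a⇒b≡𝟏 = begin
    a      ≡⟨ ⊗-identityˡ a ⟨
    𝟏 ⊗ a  ≤⟨ adj← (≤-reflexive (≡.sym a⇒b≡𝟏)) ⟩
    b      ∎

  S-greatest : ∀ {X : Set} {a} (A B : X → L) → (∀ x → a ⊗ A x ≤ B x) → a ≤ S 𝐋 A B
  S-greatest {a = a} A B a⊗A≤B = ⋀-glb _ a (λ x → adj→ (a⊗A≤B x))

module LOrderedSetProperties {𝐋 : CRL} (𝐔 : LOrderedSet 𝐋) where
  open CRL 𝐋
  open ResiduatedLatticeProperties 𝐋
  open PosetReasoning ≤-poset
  open LOrderedSet 𝐔
  open IsLEquality ≈-isLEquality renaming (refl to ≈-refl; sym to ≈-sym)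

  ≈⇒≼ : ∀ u v → (u ≈ v) ≤ (u ≼ v)
  ≈⇒≼ u v = begin
    u ≈ v                        ≤⟨ x≤y⊗x (≈-refl u) ⟩
    (u ≈ u) ⊗ (u ≈ v)            ≤⟨ x≤y⊗x (≼-refl u) ⟩
    (u ≼ u) ⊗ ((u ≈ u) ⊗ (u ≈ v)) ≡⟨ ⊗-assoc _ _ _ ⟨
    (u ≼ u) ⊗ (u ≈ u) ⊗ (u ≈ v)  ≤⟨ ≼-compat u u u v ⟩
    u ≼ v                        ∎

  ≼-≈-trans : ∀ u v w → (u ≼ v) ⊗ (v ≈ w) ≤ (u ≼ w)
  ≼-≈-trans u v w =
    ≤-trans (⊗-monoˡ-≤ (v ≈ w) (x≤x⊗y (≈-refl u))) (≼-compat u v u w)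

  ≤ᵤ-≼-trans : ∀ {u v} w → u ≤ᵤ v → (v ≼ w) ≤ (u ≼ w)
  ≤ᵤ-≼-trans {u} {v} w u≤v =
    ≤-trans (x≤y⊗x u≤v) (≼-trans u v w)

  ≼-≤ᵤ-trans : ∀ u {v w} → v ≤ᵤ w → (u ≼ v) ≤ (u ≼ w)
  ≼-≤ᵤ-trans u {v} {w} v≤w =
    ≤-trans (x≤x⊗y v≤w) (≼-trans u v w)

  isotoneGalois : (f g : U → U) →
    (∀ u v → (u ≼ v) ≤ (f u ≼ f v)) → (∀ u v → (u ≼ v) ≤ (g u ≼ g v)) →
    (∀ u → u ≤ᵤ g (f u)) → (∀ v → f (g v) ≤ᵤ v) →
    ∀ u v → (f u ≼ v) ≡ (u ≼ g v)
  isotoneGalois f g f-mono g-mono unit counit u v = ≤-antisym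
    (≤-trans (g-mono (f u) v) (≤ᵤ-≼-trans (g v) (unit u)))
    (≤-trans (f-mono u (g v)) (≼-≤ᵤ-trans (f u) (counit v)))

  dual : LOrderedSet 𝐋
  dual = record
    { U = U
    ; _≈_ = _≈_
    ; _≼_ = λ u v → v ≼ u
    ; ≈-isLEquality = ≈-isLEquality
    ; ≼-refl = ≼-refl
    ; ≼-trans = λ u v w → ≤-trans (≤-reflexive (⊗-comm (v ≼ u) (w ≼ v))) (≼-trans w v u)
    ; ≼-compat = λ u v u' v' →
        ≤-trans (≤-reflexive (⊗-swapʳ (v ≼ u) (u ≈ u') (v ≈ v'))) (≼-compat v u v' u')
    ; ≼-antisym = λ u v → ≤-trans (≼-antisym v u) (≤-reflexive (≈-sym v u))
    }

  dualCL : CompletelyLattice 𝐋 𝐔 → CompletelyLattice 𝐋 dual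
  dualCL cl = record { inf = sup ; inf-is = sup-is ; sup = inf ; sup-is = inf-is }
    where open CompletelyLattice cl

module CompletelyLatticeProperties {𝐋 : CRL} {𝐔 : LOrderedSet 𝐋}
    (cl : CompletelyLattice 𝐋 𝐔) where
  open CRL 𝐋
  open ResiduatedLatticeProperties 𝐋
  open LOrderedSet 𝐔
  open LOrderedSetProperties 𝐔
  open CompletelyLattice cl
  open IsLEquality ≈-isLEquality renaming (refl to ≈-refl)

  inf-lowerBound : ∀ V y → V y ≤ (inf V ≼ y)
  inf-lowerBound V y = ⇒-≡𝟏 (⋀-≡𝟏 _ (proj₁ (inf-is V)) y)

  inf-≤ᵤ : ∀ {V y} → V y ≡ 𝟏 → inf V ≤ᵤ y
  inf-≤ᵤ {V} {y} Vy≡𝟏 =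
    𝟏≤⇒≡𝟏 (≤-trans (≤-reflexive (≡.sym Vy≡𝟏)) (inf-lowerBound V y))

  inf-greatest : ∀ {a} V x → (∀ y → a ⊗ V y ≤ (x ≼ y)) → a ≤ (x ≼ inf V)
  inf-greatest {a} V x a⊗V≤x≼ =
    ≤-trans (⋀-glb _ a (λ y → adj→ (a⊗V≤x≼ y))) (⇒-≡𝟏 (⋀-≡𝟏 _ (proj₂ (inf-is V)) x))

  inf-≈ : ∀ {a} V u → V u ≡ 𝟏 → (∀ z → a ⊗ V z ≤ (u ≼ z)) → a ≤ (inf V ≈ u)
  inf-≈ V u Vu≡𝟏 a⊗V≤u≼ = ≤-trans
    (∧-greatest (≤-trans x≤𝟏 (≤-reflexive (≡.sym (inf-≤ᵤ Vu≡𝟏))))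
                (inf-greatest V u a⊗V≤u≼))
    (≼-antisym (inf V) u)

  inf-singleton : ∀ u → inf (u ≈_) ≡ u
  inf-singleton u = sep (inf (u ≈_)) u
    (𝟏≤⇒≡𝟏 (inf-≈ (u ≈_) u (≈-refl u) (λ z → ≤-trans x⊗y≤y (≈⇒≼ u z))))

  pair : U → U → U → L
  pair u v z = (u ≈ z) ∨ (v ≈ z)

  pair-∋ˡ : ∀ u v → pair u v u ≡ 𝟏
  pair-∋ˡ u v = ∨-≡𝟏ˡ (≈-refl u)

  pair-∋ʳ : ∀ u v → pair u v v ≡ 𝟏
  pair-∋ʳ u v = ∨-≡𝟏ʳ (≈-refl v)

  inf-pair-≈ : ∀ u v → (u ≼ v) ≤ (inf (pair u v) ≈ u)
  inf-pair-≈ u v = inf-≈ (pair u v) u (pair-∋ˡ u v)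
    (λ z → ⊗-∨-least (≤-trans x⊗y≤y (≈⇒≼ u z)) (≼-≈-trans u v z))

  dual-isCompleteRel : ∀ {R} → IsCompleteRel 𝐋 cl R → IsCompleteRel 𝐋 (dualCL cl) R
  dual-isCompleteRel (R-compat , R-inf , R-sup) = R-compat , R-sup , R-inf

module InfCompleteTolerance {𝐋 : CRL} {𝐔 : LOrderedSet 𝐋} (cl : CompletelyLattice 𝐋 𝐔)
    (R : LOrderedSet.U 𝐔 → LOrderedSet.U 𝐔 → CRL.L 𝐋)
    (tolerance : IsTolerance 𝐋 cl R) (complete : IsCompleteRel 𝐋 cl R) where
  open CRL 𝐋
  open ResiduatedLatticeProperties 𝐋
  open PosetReasoning ≤-poset
  open LOrderedSet 𝐔
  open LOrderedSetProperties 𝐔 using (≼-≤ᵤ-trans)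
  open CompletelyLattice cl
  open CompletelyLatticeProperties cl
  open IsLEquality ≈-isLEquality renaming (refl to ≈-refl)

  private
    R-refl = proj₁ tolerance
    R-sym = proj₂ tolerance
    R-compat = proj₁ complete
    R-inf = proj₁ (proj₂ complete)

  lower : U → U
  lower = lowerᵗ 𝐋 cl R

  ≈⇒R : ∀ u v → (u ≈ v) ≤ R u v
  ≈⇒R u v = begin
    u ≈ v                      ≤⟨ x≤y⊗x (≈-refl u) ⟩
    (u ≈ u) ⊗ (u ≈ v)          ≤⟨ x≤y⊗x (R-refl u) ⟩
    R u u ⊗ ((u ≈ u) ⊗ (u ≈ v)) ≡⟨ ⊗-assoc _ _ _ ⟨
    R u u ⊗ (u ≈ u) ⊗ (u ≈ v)  ≤⟨ R-compat u u u v ⟩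
    R u v                      ∎

  R-≈-transˡ : ∀ u v u' → R u v ⊗ (u ≈ u') ≤ R u' v
  R-≈-transˡ u v u' = ≤-trans (x≤x⊗y (≈-refl v)) (R-compat u v u' v)

  R-≈-transʳ : ∀ u v v' → R u v ⊗ (v ≈ v') ≤ R u v'
  R-≈-transʳ u v v' =
    ≤-trans (⊗-monoˡ-≤ (v ≈ v') (x≤x⊗y (≈-refl u))) (R-compat u v u v')

  R-lower : ∀ u → R (lower u) u ≡ 𝟏
  R-lower u = 𝟏≤⇒≡𝟏 (begin
    𝟏                                   ≤⟨ ∧-greatest class⊆R∘singleton singleton⊆class∘R ⟩
    _⁺ 𝐋 R (R u) (u ≈_)                ≤⟨ R-inf (R u) (u ≈_) ⟩
    R (lower u) (inf (u ≈_))            ≡⟨ cong (R (lower u)) (inf-singleton u) ⟩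
    R (lower u) u                       ∎)
    where
    class⊆R∘singleton : 𝟏 ≤ S 𝐋 (R u) (_∘ʳ_ 𝐋 R (u ≈_))
    class⊆R∘singleton = S-greatest _ _ λ x →
      ≤-trans x⊗y≤y (≤-⋁ _ u (≤-trans (≤-reflexive (R-sym u x)) (x≤x⊗y (≈-refl u))))
    singleton⊆class∘R : 𝟏 ≤ S 𝐋 (u ≈_) (_ˡ∘_ 𝐋 (R u) R)
    singleton⊆class∘R = S-greatest _ _ λ y →
      ≤-trans x⊗y≤y (≤-⋁ _ u (≤-trans (≈⇒R u y) (x≤y⊗x (R-refl u))))

  lower-≤ᵤ : ∀ {w u} → R w u ≡ 𝟏 → lower w ≤ᵤ u
  lower-≤ᵤ = inf-≤ᵤ

  lower-extensive : ∀ u → lower u ≤ᵤ u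
  lower-extensive u = lower-≤ᵤ (R-refl u)

  R⁺-pair : ∀ u v y → R v y ≤ _⁺ 𝐋 R (pair u v) (pair u y)
  R⁺-pair u v y = ∧-greatest
    (S-greatest _ _ λ z → ⊗-∨-least
      (≤-trans x⊗y≤y (≤-trans (≈⇒R u z) (≤-trans (≤-reflexive (R-sym u z))
        (≤-⋁ _ u (x≤x⊗y (pair-∋ˡ u y))))))
      (≤-trans (R-≈-transˡ v y z) (≤-⋁ _ y (x≤x⊗y (pair-∋ʳ u y)))))
    (S-greatest _ _ λ x → ⊗-∨-least
      (≤-trans x⊗y≤y (≤-trans (≈⇒R u x) (≤-⋁ _ u (x≤y⊗x (pair-∋ˡ u v)))))
      (≤-trans (R-≈-transʳ v y x) (≤-⋁ _ v (x≤y⊗x (pair-∋ʳ u v)))))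

  lower-mono : ∀ u v → (u ≼ v) ≤ (lower u ≼ lower v)
  lower-mono u v = inf-greatest (R v) (lower u) λ y →
    let w₁ = inf (pair u v) ; w₂ = inf (pair u y) in begin
    (u ≼ v) ⊗ R v y    ≡⟨ ⊗-comm (u ≼ v) (R v y) ⟩
    R v y ⊗ (u ≼ v)    ≤⟨ ⊗-mono-≤ (≤-trans (R⁺-pair u v y) (R-inf _ _)) (inf-pair-≈ u v) ⟩
    R w₁ w₂ ⊗ (w₁ ≈ u) ≤⟨ R-≈-transˡ w₁ w₂ u ⟩
    R u w₂             ≤⟨ inf-lowerBound (R u) w₂ ⟩
    (lower u ≼ w₂)     ≤⟨ ≼-≤ᵤ-trans (lower u) (inf-≤ᵤ (pair-∋ʳ u y)) ⟩
    (lower u ≼ y)      ∎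

theorem11 : (𝐋 : CRL) (𝐔 : LOrderedSet 𝐋) (cl : CompletelyLattice 𝐋 𝐔)
    (R : LOrderedSet.U 𝐔 → LOrderedSet.U 𝐔 → CRL.L 𝐋) →
    IsTolerance 𝐋 cl R → IsCompleteRel 𝐋 cl R →
    IsIsotoneGalois 𝐋 cl (lowerᵗ 𝐋 cl R) (upperᵗ 𝐋 cl R)
    × IsExtensive 𝐋 cl (lowerᵗ 𝐋 cl R) (upperᵗ 𝐋 cl R)
theorem11 𝐋 𝐔 cl R tolerance complete =
  isotoneGalois ∼.lower ∼ᵈ.lower ∼.lower-mono (λ u v → ∼ᵈ.lower-mono v u)
    (λ u → ∼ᵈ.lower-≤ᵤ (∼.R-lower u)) (λ v → ∼.lower-≤ᵤ (∼ᵈ.R-lower v))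
  , ∼.lower-extensive , ∼ᵈ.lower-extensive
  where
  open LOrderedSetProperties 𝐔
  module ∼ = InfCompleteTolerance cl R tolerance complete
  module ∼ᵈ = InfCompleteTolerance (dualCL cl) R tolerance
                (CompletelyLatticeProperties.dual-isCompleteRel cl complete)
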